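{- For every integer $n\ge 7$, $$ex_{\mathcal{OP}}(n,S_{2,3})\ge\begin{cases}\frac{5n-3}{3}, & \text{if } n\equiv 0 \pmod 6,\\ \frac{5n-5}{3}, & \text{if } n\equiv 1 \pmod 6,\\ \frac{5n+i-9}{3}, & \text{if } n\equiv i \pmod 6,\ i\in\{2,3,4,5\}.\end{cases}$$
   Context: All graphs are finite, simple and undirected. For integers $q\ge p\ge 1$, the double star $S_{p,q}$ is the graph obtained from an edge $xy$ by joining $x$ to $p$ new vertices and $y$ to $q$ further new vertices. A graph is $H$-free if it contains no subgraph isomorphic to $H$. A graph is outerplanar if it has a planar embedding with all vertices on the boundary of the outer face. $ex_{\mathcal{OP}}(n,H)$ denotes the maximum number of edges of an $H$-free outerplanar graph on $n$ vertices. -}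

module Defs where

open import Data.Nat using (ℕ; zero; suc; _+_; _*_; _∸_; _<_; _≤_; _≡ᵇ_; _≤ᵇ_; _<ᵇ_; _%_)
open import Data.Bool using (Bool; true; false; _∧_; _∨_; if_then_else_)
open import Data.Bool.Properties using (∨-comm)
open import Data.Fin using (Fin; toℕ)
open import Data.List using (List; map; allFin)
open import Data.Nat.ListAction using (sum)
open import Data.Empty using (⊥)
open import Data.Product using (Σ; _×_; _,_)
open import Function.Definitions using (Injective)
open import Relation.Binary.PropositionalEquality using (_≡_; refl)

record Graph (n : ℕ) : Set where
  field
    adj    : Fin n → Fin n → Bool
    sym    : ∀ i j → adj i j ≡ adj j i
    irrefl : ∀ i → adj i i ≡ false
open Graph public

edgeCount : ∀ {n} → Graph n → ℕ
edgeCount {n} G =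
  sum (map (λ i → sum (map (λ j → if (adj G i j ∧ (toℕ i <ᵇ toℕ j)) then 1 else 0)
                           (allFin n)))
           (allFin n))

Contains : ∀ {m n} → Graph n → Graph m → Set
Contains {m} {n} G H =
  Σ (Fin m → Fin n) λ f → Injective _≡_ _≡_ f ×
    (∀ i j → adj H i j ≡ true → adj G (f i) (f j) ≡ true)

Free : ∀ {m n} → Graph m → Graph n → Set
Free H G = Contains G H → ⊥

-- Double star S_{p,q} on vertices 0 .. p+q+1:
-- x = 0, y = 1, leaves of x = 2 .. p+1, leaves of y = p+2 .. p+q+1.
dsRel : ℕ → ℕ → ℕ → Bool
dsRel p a b = ((a ≡ᵇ 0) ∧ (b ≡ᵇ 1))
            ∨ ((a ≡ᵇ 0) ∧ ((2 ≤ᵇ b) ∧ (b ≤ᵇ suc p)))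
            ∨ ((a ≡ᵇ 1) ∧ (suc (suc p) ≤ᵇ b))

dsAdj : ℕ → ℕ → ℕ → Bool
dsAdj p a b = dsRel p a b ∨ dsRel p b a

dsIrrefl : ∀ p a → dsAdj p a a ≡ false
dsIrrefl p zero = refl
dsIrrefl p (suc zero) = refl
dsIrrefl p (suc (suc a)) = refl

doubleStar : (p q : ℕ) → Graph (2 + p + q)
doubleStar p q = record
  { adj    = λ i j → dsAdj p (toℕ i) (toℕ j)
  ; sym    = λ i j → ∨-comm (dsRel p (toℕ i) (toℕ j)) (dsRel p (toℕ j) (toℕ i))
  ; irrefl = λ i → dsIrrefl p (toℕ i)
  }

-- Outerplanarity, combinatorially: the vertices can be placed at distinct
-- positions on a circle (a cyclic order given by an injective position map
-- into Fin n) so that drawing edges as chords produces no crossing, i.e.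
-- no two edges ab, cd with pos a < pos c < pos b < pos d.
Outerplanar : ∀ {n} → Graph n → Set
Outerplanar {n} G =
  Σ (Fin n → Fin n) λ pos → Injective _≡_ _≡_ pos ×
    (∀ a b c d → adj G a b ≡ true → adj G c d ≡ true →
       toℕ (pos a) < toℕ (pos c) → toℕ (pos c) < toℕ (pos b) →
       toℕ (pos b) < toℕ (pos d) → ⊥)

-- Three times the lower bound of Theorem 5 (so it is an exact natural number).
threeBound : ℕ → ℕ
threeBound n with n % 6
... | 0 = 5 * n ∸ 3
... | 1 = 5 * n ∸ 5
... | i = 5 * n + i ∸ 9

-- The graph joins a to a + 1 for every a, and a to a + 2 whenever a mod 6 < 4.
-- Its edges have length 1 or 2, so it lies inside the ladder whose boundary cycle is
-- 0, 2, 4, …, 5, 3, 1; placing the vertices on a circle in that order, every edge joins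
-- neighbouring points or is a rung whose endpoint positions sum to n − 1 or n, and two
-- such rungs cannot cross.  For every edge xy the closed neighbourhoods of x and y lie in
-- six consecutive integers (for an edge a(a + 2) because a − 2, a, a + 2 are never all
-- 0, 1, 2 or 3 mod 6), whereas all seven vertices of S_{2,3} are adjacent to an end of its
-- central edge; by pigeonhole there is no S_{2,3}.  Vertex a + 2 has 1 + [a mod 6 < 4]
-- neighbours below it, so every six vertices add ten edges, and 3 e(n) equals the bound.

module Submission where

open import Defs hiding (sym)
open import Data.Bool using (Bool; true; false; _∧_; if_then_else_)
open import Data.Bool.Properties using (∧-identityʳ; ∧-zeroʳ)
open import Data.Empty using (⊥; ⊥-elim)
open import Data.Fin using (Fin; zero; suc; toℕ; fromℕ<)
open import Data.Fin.Properties using (toℕ-fromℕ<; toℕ-injective; toℕ<n; pigeonhole)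
import Data.Fin.Properties as Fin
open import Data.List using (map; allFin; tabulate)
open import Data.List.Properties using (map-cong; map-tabulate)
open import Data.Nat using (ℕ; zero; suc; _+_; _*_; _∸_; _≤_; _<_; _<ᵇ_; _%_; z≤n; s≤s; s≤s⁻¹; ⌊_/2⌋; ⌈_/2⌉; parity)
open import Data.Nat.DivMod using (%-distribˡ-+; m%n<n; m<n⇒m%n≡m)
open import Data.Nat.ListAction using (sum)
open import Data.Nat.Properties
open import Algebra.Properties.CommutativeSemigroup +-commutativeSemigroup using (interchange)
open import Data.Parity.Base using (Parity; 0ℙ; 1ℙ)
open import Data.Product using (Σ; ∃₂; _×_; _,_; proj₁; proj₂)
open import Data.Sum using (_⊎_; inj₁; inj₂; swap)
open import Function using (_∘_)
open import Function.Bundles using (mk⇔)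
open import Relation.Binary using (Decidable; Symmetric)
open import Relation.Binary.PropositionalEquality
open import Relation.Nullary using (¬_; Dec; yes; no; does; contradiction)
open import Relation.Nullary.Decidable using (_⊎-dec_; dec-true; dec-false; does-⇔)
open import Relation.Nullary.Reflects using (ofʸ; ofⁿ)

sumBelow : ℕ → (ℕ → ℕ) → ℕ
sumBelow zero    f = 0
sumBelow (suc n) f = sumBelow n f + f n

syntax sumBelow n (λ i → e) = ∑[ i < n ] e

sumBelow-cong : ∀ n {f g : ℕ → ℕ} → (∀ {i} → i < n → f i ≡ g i) → sumBelow n f ≡ sumBelow n g
sumBelow-cong zero    _   = refl
sumBelow-cong (suc n) f≗g = cong₂ _+_ (sumBelow-cong n (f≗g ∘ m<n⇒m<1+n)) (f≗g (n<1+n n))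

sumBelow-zero : ∀ n {f : ℕ → ℕ} → (∀ {i} → i < n → f i ≡ 0) → sumBelow n f ≡ 0
sumBelow-zero zero    _   = refl
sumBelow-zero (suc n) f≗0 = cong₂ _+_ (sumBelow-zero n (f≗0 ∘ m<n⇒m<1+n)) (f≗0 (n<1+n n))

sumBelow-+ : ∀ n (f g : ℕ → ℕ) → ∑[ i < n ] (f i + g i) ≡ sumBelow n f + sumBelow n g
sumBelow-+ zero    f g = refl
sumBelow-+ (suc n) f g = trans (cong (_+ (f n + g n)) (sumBelow-+ n f g))
                               (interchange (sumBelow n f) (sumBelow n g) (f n) (g n))

sumBelow-head : ∀ n (f : ℕ → ℕ) → sumBelow (suc n) f ≡ f 0 + sumBelow n (f ∘ suc)
sumBelow-head zero    f = +-comm 0 (f 0)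
sumBelow-head (suc n) f = trans (cong (_+ f (suc n)) (sumBelow-head n f))
                                (+-assoc (f 0) (sumBelow n (f ∘ suc)) (f (suc n)))

sum-tabulate-toℕ : ∀ n (f : ℕ → ℕ) → sum (tabulate {n = n} (f ∘ toℕ)) ≡ sumBelow n f
sum-tabulate-toℕ zero    f = refl
sum-tabulate-toℕ (suc n) f = trans (cong (f 0 +_) (sum-tabulate-toℕ n (f ∘ suc)))
                                   (sym (sumBelow-head n f))

sum-allFin : ∀ n (f : ℕ → ℕ) → sum (map (f ∘ toℕ) (allFin n)) ≡ sumBelow n f
sum-allFin n f = trans (cong sum (map-tabulate {n = n} (λ i → i) (f ∘ toℕ))) (sum-tabulate-toℕ n f)

indicator : Bool → ℕ
indicator b = if b then 1 else 0

-- Drawing the ladder on a circle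

data Short : ℕ → ℕ → Set where
  one : ∀ a → Short a (1 + a)
  two : ∀ a → Short a (2 + a)

place : Parity → ℕ → ℕ → ℕ
place 0ℙ n h = h
place 1ℙ n h = n ∸ suc h

-- Position on the boundary cycle 0, 2, 4, …, 5, 3, 1 of the ladder on n vertices.
position : ℕ → ℕ → ℕ
position n a = place (parity a) n ⌊ a /2⌋

data Chord (n p q : ℕ) : Set where
  side : suc p ≡ q ⊎ suc q ≡ p → Chord n p q
  rung : suc (p + q) ≡ n ⊎ p + q ≡ n → Chord n p q

chord-sym : ∀ {n p q} → Chord n p q → Chord n q p
chord-sym         (side e)         = side (swap e)
chord-sym {p = p} (rung (inj₁ e)) = rung (inj₁ (trans (cong suc (+-comm _ p)) e))
chord-sym {p = p} (rung (inj₂ e)) = rung (inj₂ (trans (+-comm _ p) e))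

long-chord : ∀ {n p q} → suc p < q → Chord n p q → n ≤ suc (p + q) × p + q ≤ n
long-chord p+1<q (side (inj₁ refl)) = contradiction p+1<q (<-irrefl refl)
long-chord p+1<q (side (inj₂ refl)) = contradiction p+1<q (m+n≮n 2 _)
long-chord _     (rung (inj₁ e))    = ≤-reflexive (sym e) , ≤-trans (n≤1+n _) (≤-reflexive e)
long-chord _     (rung (inj₂ e))    = ≤-trans (≤-reflexive (sym e)) (n≤1+n _) , ≤-reflexive e

chords-noncrossing : ∀ {n p q r t} → p < r → r < q → q < t → Chord n p q → Chord n r t → ⊥
chords-noncrossing {n} {p} {q} {r} {t} p<r r<q q<t pq rt = <-irrefl refl (begin-strict
  n               ≤⟨ proj₁ (long-chord (≤-<-trans p<r r<q) pq) ⟩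
  suc (p + q)     <⟨ subst (suc (p + q) <_) (sym (cong suc (+-suc p q))) (n<1+n _) ⟩
  suc p + suc q   ≤⟨ +-mono-≤ {suc p} {r} {suc q} {t} p<r q<t ⟩
  r + t           ≤⟨ proj₂ (long-chord (≤-<-trans r<q q<t) rt) ⟩
  n               ∎)
  where open ≤-Reasoning

parity-suc : ∀ a → (parity a ≡ 0ℙ × parity (suc a) ≡ 1ℙ × ⌈ a /2⌉ ≡ ⌊ a /2⌋)
                 ⊎ (parity a ≡ 1ℙ × parity (suc a) ≡ 0ℙ × ⌈ a /2⌉ ≡ suc ⌊ a /2⌋)
parity-suc zero          = inj₁ (refl , refl , refl)
parity-suc (suc zero)    = inj₂ (refl , refl , refl)
parity-suc (suc (suc a)) with parity-suc a
... | inj₁ (pa , pa+1 , e) = inj₁ (pa , pa+1 , cong suc e)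
... | inj₂ (pa , pa+1 , e) = inj₂ (pa , pa+1 , cong suc e)

halves-even : ∀ {a} → parity a ≡ 0ℙ → ⌊ a /2⌋ + ⌊ a /2⌋ ≡ a
halves-even {a} pa with parity-suc a
... | inj₁ (_ , _ , e)  = trans (cong (⌊ a /2⌋ +_) (sym e)) (⌊n/2⌋+⌈n/2⌉≡n a)
... | inj₂ (pa′ , _ , _) = contradiction (trans (sym pa) pa′) λ ()

halves-odd : ∀ {a} → parity a ≡ 1ℙ → ⌊ a /2⌋ + suc ⌊ a /2⌋ ≡ a
halves-odd {a} pa with parity-suc a
... | inj₂ (_ , _ , e)  = trans (cong (⌊ a /2⌋ +_) (sym e)) (⌊n/2⌋+⌈n/2⌉≡n a)
... | inj₁ (pa′ , _ , _) = contradiction (trans (sym pa) pa′) λ ()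

⌊/2⌋-< : ∀ {n a} → a < n → ⌊ a /2⌋ < n
⌊/2⌋-< {a = a} = ≤-<-trans (⌊n/2⌋≤n a)

position-< : ∀ {n a} → a < n → position n a < n
position-< {n}     {a} a<n with parity a
position-< {n}     {a} a<n | 0ℙ = ⌊/2⌋-< a<n
position-< {suc n} {a} a<n | 1ℙ = s≤s (m∸n≤m n ⌊ a /2⌋)

even-odd-positions-differ : ∀ {n a b} → parity a ≡ 0ℙ → parity b ≡ 1ℙ → a < n → b < n →
                            ⌊ a /2⌋ ≢ n ∸ suc ⌊ b /2⌋
even-odd-positions-differ {n} {a} {b} pa pb a<n b<n h≡ = <⇒≱ k<h (s≤s⁻¹ h<1+k)
  where
  h k : ℕ
  h = ⌊ a /2⌋
  k = ⌊ b /2⌋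
  total : h + suc k ≡ n
  total = trans (cong (_+ suc k) h≡) (m∸n+n≡m (⌊/2⌋-< b<n))
  h<1+k : h < suc k
  h<1+k = +-cancelˡ-< h h (suc k) (subst₂ _<_ (sym (halves-even pa)) (sym total) a<n)
  k<h : k < h
  k<h = +-cancelʳ-< (suc k) k h (subst₂ _<_ (sym (halves-odd pb)) (sym total) b<n)

position-injective : ∀ {n a b} → a < n → b < n → position n a ≡ position n b → a ≡ b
position-injective {n} {a} {b} a<n b<n eq with parity a in pa | parity b in pb
... | 0ℙ | 0ℙ = trans (sym (halves-even pa)) (trans (cong₂ _+_ eq eq) (halves-even pb))
... | 1ℙ | 1ℙ = trans (sym (halves-odd pa)) (trans (cong (λ h → h + suc h) ha≡hb) (halves-odd pb))
  where
  ha≡hb : ⌊ a /2⌋ ≡ ⌊ b /2⌋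
  ha≡hb = suc-injective (∸-cancelˡ-≡ (⌊/2⌋-< a<n) (⌊/2⌋-< b<n) eq)
... | 0ℙ | 1ℙ = contradiction eq (even-odd-positions-differ pa pb a<n b<n)
... | 1ℙ | 0ℙ = contradiction (sym eq) (even-odd-positions-differ pb pa b<n a<n)

short-chord : ∀ {n a b} → Short a b → b < n → Chord n (position n a) (position n b)
short-chord {n} (one a) a+1<n with ⌊/2⌋-< (<-trans (n<1+n a) a+1<n) | parity-suc a
... | h<n | inj₁ (pa , pa+1 , e) rewrite pa | pa+1 | e = rung (inj₁ (m+[n∸m]≡n h<n))
... | h<n | inj₂ (pa , pa+1 , e) rewrite pa | pa+1 | e = rung (inj₂ (m∸n+n≡m h<n))
short-chord {n} (two a) a+2<n with parity a
... | 0ℙ = side (inj₁ refl)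
... | 1ℙ = side (inj₂ (sym (+-∸-assoc 1 (⌊/2⌋-< a+2<n))))

doubleStar-dominated : ∀ p q (i : Fin (2 + p + q)) →
  (i ≡ zero ⊎ adj (doubleStar p q) zero i ≡ true) ⊎ (i ≡ suc zero ⊎ adj (doubleStar p q) (suc zero) i ≡ true)
doubleStar-dominated p q zero          = inj₁ (inj₁ refl)
doubleStar-dominated p q (suc zero)    = inj₂ (inj₁ refl)
doubleStar-dominated p q (suc (suc i)) with toℕ i <ᵇ p | <ᵇ-reflects-< (toℕ i) p
... | true  | _      = inj₁ (inj₂ refl)
... | false | ofⁿ i≮p with p <ᵇ suc (toℕ i) | <ᵇ-reflects-< p (suc (toℕ i))
...   | true  | _      = inj₂ (inj₂ refl)
...   | false | ofⁿ p≮i+1 = contradiction (s≤s (≮⇒≥ i≮p)) p≮i+1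

module InducedGraph {_~_ : ℕ → ℕ → Set} (_~?_ : Decidable _~_)
                    (~-sym : Symmetric _~_) (~-irrefl : ∀ a → ¬ a ~ a) where

  induced : ∀ n → Graph n
  induced n = record
    { adj    = λ i j → does (toℕ i ~? toℕ j)
    ; sym    = λ i j → does-⇔ (mk⇔ ~-sym ~-sym) (toℕ i ~? toℕ j) (toℕ j ~? toℕ i)
    ; irrefl = λ i → dec-false (toℕ i ~? toℕ i) (~-irrefl (toℕ i))
    }

  adjacent : ∀ {a b} → does (a ~? b) ≡ true → a ~ b
  adjacent {a} {b} _  with a ~? b
  adjacent         _  | yes a~b = a~b
  adjacent         () | no _

  forwardEdge : ℕ → ℕ → ℕ
  forwardEdge u v = indicator (does (u ~? v) ∧ (u <ᵇ v))

  backDegree : ℕ → ℕ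
  backDegree n = ∑[ u < n ] indicator (does (u ~? n))

  edgeCount-induced : ∀ n → edgeCount (induced n) ≡ ∑[ u < n ] ∑[ v < n ] forwardEdge u v
  edgeCount-induced n =
    trans (cong sum (map-cong (λ i → sum-allFin n (forwardEdge (toℕ i))) (allFin n)))
          (sum-allFin n (λ u → ∑[ v < n ] forwardEdge u v))

  edgeCount-induced-suc : ∀ n → edgeCount (induced (suc n)) ≡ edgeCount (induced n) + backDegree n
  edgeCount-induced-suc n = begin
    edgeCount (induced (suc n))
      ≡⟨ edgeCount-induced (suc n) ⟩
    ∑[ u < n ] (∑[ v < n ] forwardEdge u v + forwardEdge u n) + ∑[ v < suc n ] forwardEdge n v
      ≡⟨ cong₂ _+_ (sumBelow-+ n _ _) (sumBelow-zero (suc n) no-edge-up) ⟩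
    (∑[ u < n ] ∑[ v < n ] forwardEdge u v + ∑[ u < n ] forwardEdge u n) + 0
      ≡⟨ +-identityʳ _ ⟩
    ∑[ u < n ] ∑[ v < n ] forwardEdge u v + ∑[ u < n ] forwardEdge u n
      ≡⟨ cong₂ _+_ (sym (edgeCount-induced n)) (sumBelow-cong n edge-down) ⟩
    edgeCount (induced n) + backDegree n ∎
    where
    open ≡-Reasoning
    no-edge-up : ∀ {v} → v < suc n → forwardEdge n v ≡ 0
    no-edge-up {v} v≤n with n <ᵇ v | <ᵇ-reflects-< n v
    ... | true  | ofʸ n<v = contradiction v≤n (<⇒≱ n<v ∘ s≤s⁻¹)
    ... | false | _       = cong indicator (∧-zeroʳ _)
    edge-down : ∀ {u} → u < n → forwardEdge u n ≡ indicator (does (u ~? n))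
    edge-down {u} u<n with u <ᵇ n | <ᵇ-reflects-< u n
    ... | true  | _       = cong indicator (∧-identityʳ _)
    ... | false | ofⁿ u≮n = contradiction u<n u≮n

  edgeCount-induced-+ : ∀ d m → edgeCount (induced (d + m)) ≡ edgeCount (induced m) + ∑[ j < d ] backDegree (j + m)
  edgeCount-induced-+ zero    m = sym (+-identityʳ _)
  edgeCount-induced-+ (suc d) m =
    trans (edgeCount-induced-suc (d + m))
          (trans (cong (_+ backDegree (d + m)) (edgeCount-induced-+ d m))
                 (+-assoc (edgeCount (induced m)) (∑[ j < d ] backDegree (j + m)) (backDegree (d + m))))

  Near : ℕ → ℕ → Set
  Near x v = v ≡ x ⊎ x ~ v

  -- P lies in the k + 1 consecutive integers s − d, …, s − d + k (shifted by d to avoid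
  -- truncated subtraction).
  WithinWindow : ℕ → (ℕ → Set) → Set
  WithinWindow k P = ∃₂ λ s d → ∀ {v} → P v → s ≤ d + v × d + v ≤ k + s

  induced-doubleStar-free : ∀ p q →
    (∀ {x y} → x ~ y → WithinWindow (p + q) (λ v → Near x v ⊎ Near y v)) →
    ∀ n → Free (doubleStar p q) (induced n)
  induced-doubleStar-free p q narrow n (f , f-injective , f-edge) =
    let (i , j , i<j , same) = pigeonhole (n<1+n (1 + p + q)) offset
    in Fin.<-irrefl (offset-injective same) i<j
    where
    x y : ℕ
    x = toℕ (f zero)
    y = toℕ (f (suc zero))

    window : WithinWindow (p + q) (λ v → Near x v ⊎ Near y v)
    window = narrow (adjacent (f-edge zero (suc zero) refl))

    s d : ℕ
    s = proj₁ window
    d = proj₁ (proj₂ window)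

    near : ∀ i → Near x (toℕ (f i)) ⊎ Near y (toℕ (f i))
    near i with doubleStar-dominated p q i
    ... | inj₁ (inj₁ refl) = inj₁ (inj₁ refl)
    ... | inj₁ (inj₂ e)    = inj₁ (inj₂ (adjacent (f-edge zero i e)))
    ... | inj₂ (inj₁ refl) = inj₂ (inj₁ refl)
    ... | inj₂ (inj₂ e)    = inj₂ (inj₂ (adjacent (f-edge (suc zero) i e)))

    bounds : ∀ i → s ≤ d + toℕ (f i) × d + toℕ (f i) ≤ p + q + s
    bounds i = proj₂ (proj₂ window) (near i)

    offset : Fin (2 + p + q) → Fin (1 + p + q)
    offset i = fromℕ< (s≤s (subst (d + toℕ (f i) ∸ s ≤_) (m+n∸n≡m (p + q) s)
                                  (∸-monoˡ-≤ s (proj₂ (bounds i)))))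

    offset-injective : ∀ {i j} → offset i ≡ offset j → i ≡ j
    offset-injective {i} {j} eq =
      f-injective (toℕ-injective (+-cancelˡ-≡ d _ _
        (∸-cancelʳ-≡ (proj₁ (bounds i)) (proj₁ (bounds j))
          (trans (sym (toℕ-fromℕ< _)) (trans (cong toℕ eq) (toℕ-fromℕ< _))))))

  induced-outerplanar : (∀ {a b} → a ~ b → Short a b ⊎ Short b a) → ∀ n → Outerplanar (induced n)
  induced-outerplanar short n = pos , pos-injective , no-crossing
    where
    pos : Fin n → Fin n
    pos i = fromℕ< (position-< (toℕ<n i))

    toℕ-pos : ∀ i → toℕ (pos i) ≡ position n (toℕ i)
    toℕ-pos i = toℕ-fromℕ< _

    pos-injective : ∀ {i j} → pos i ≡ pos j → i ≡ j
    pos-injective {i} {j} eq = toℕ-injective (position-injective (toℕ<n i) (toℕ<n j)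
      (trans (sym (toℕ-pos i)) (trans (cong toℕ eq) (toℕ-pos j))))

    chord : ∀ i j → adj (induced n) i j ≡ true → Chord n (toℕ (pos i)) (toℕ (pos j))
    chord i j e rewrite toℕ-pos i | toℕ-pos j with short (adjacent e)
    ... | inj₁ i→j = short-chord i→j (toℕ<n j)
    ... | inj₂ j→i = chord-sym (short-chord j→i (toℕ<n i))

    no-crossing : ∀ a b c d → adj (induced n) a b ≡ true → adj (induced n) c d ≡ true →
      toℕ (pos a) < toℕ (pos c) → toℕ (pos c) < toℕ (pos b) → toℕ (pos b) < toℕ (pos d) → ⊥
    no-crossing a b c d ab cd a<c c<b b<d = chords-noncrossing a<c c<b b<d (chord a b ab) (chord c d cd)

Skip : ℕ → Set
Skip a = a % 6 < 4

skip? : ∀ a → Dec (Skip a)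
skip? a = a % 6 <? 4

no-three-skips : ∀ a → Skip a → Skip (2 + a) → Skip (4 + a) → ⊥
no-three-skips a sa s2 s4 =
  by-residue (a % 6) (m%n<n a 6) sa (subst (_< 4) (%-distribˡ-+ 2 a 6) s2)
                                    (subst (_< 4) (%-distribˡ-+ 4 a 6) s4)
  where
  by-residue : ∀ r → r < 6 → r < 4 → (2 + r) % 6 < 4 → (4 + r) % 6 < 4 → ⊥
  by-residue 0 _ _ _ s4 = m+n≮m 4 0 s4
  by-residue 1 _ _ _ s4 = m+n≮m 4 1 s4
  by-residue 2 _ _ s2 _ = m+n≮m 4 0 s2
  by-residue 3 _ _ s2 _ = m+n≮m 4 1 s2
  by-residue 4 _ s0 _ _ = m+n≮m 4 0 s0
  by-residue 5 _ s0 _ _ = m+n≮m 4 1 s0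
  by-residue (suc (suc (suc (suc (suc (suc r)))))) r<6 _ _ _ = m+n≮m 6 r r<6

infix 4 _↝_ _↝?_

data _↝_ : ℕ → ℕ → Set where
  next : ∀ a → a ↝ suc a
  jump : ∀ {a} → Skip a → a ↝ 2 + a

_↝?_ : Decidable _↝_
a ↝? b with b ≟ suc a | b ≟ 2 + a | skip? a
... | yes refl | _        | _      = yes (next a)
... | no _     | yes refl | yes sa = yes (jump sa)
... | no _     | yes refl | no ¬sa = no λ { (jump sa) → ¬sa sa }
... | no b≢1+a | no b≢2+a | _      = no λ { (next _) → b≢1+a refl ; (jump _) → b≢2+a refl }

Linked : ℕ → ℕ → Set
Linked a b = a ↝ b ⊎ b ↝ a

linked? : Decidable Linked
linked? a b = (a ↝? b) ⊎-dec (b ↝? a)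

linked-irrefl : ∀ a → ¬ Linked a a
linked-irrefl a (inj₁ ())
linked-irrefl a (inj₂ ())

↝-short : ∀ {a b} → a ↝ b → Short a b
↝-short (next a) = one a
↝-short (jump _) = two _

linked-short : ∀ {a b} → Linked a b → Short a b ⊎ Short b a
linked-short (inj₁ a↝b) = inj₁ (↝-short a↝b)
linked-short (inj₂ b↝a) = inj₂ (↝-short b↝a)

open InducedGraph linked? swap linked-irrefl

near-below : ∀ {x v} → Near x v → x ≤ 1 + v ⊎ (x ≡ 2 + v × Skip v)
near-below (inj₁ refl)             = inj₁ (n≤1+n _)
near-below (inj₂ (inj₁ (next _)))  = inj₁ (≤-trans (n≤1+n _) (n≤1+n _))
near-below (inj₂ (inj₁ (jump _)))  = inj₁ (m≤n+m _ 3)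
near-below (inj₂ (inj₂ (next _)))  = inj₁ ≤-refl
near-below (inj₂ (inj₂ (jump sv))) = inj₂ (refl , sv)

near-above : ∀ {x v} → Near x v → v ≤ 1 + x ⊎ (v ≡ 2 + x × Skip x)
near-above (inj₁ refl)             = inj₁ (n≤1+n _)
near-above (inj₂ (inj₁ (next _)))  = inj₁ ≤-refl
near-above (inj₂ (inj₁ (jump sx))) = inj₂ (refl , sx)
near-above (inj₂ (inj₂ (next _)))  = inj₁ (≤-trans (n≤1+n _) (n≤1+n _))
near-above (inj₂ (inj₂ (jump _)))  = inj₁ (m≤n+m _ 3)

near-bounds : ∀ {x v} → Near x v → x ≤ 2 + v × v ≤ 2 + x
near-bounds near = within-2 (near-below near) , within-2 (near-above near)
  where
  within-2 : ∀ {a b} {P : Set} → a ≤ 1 + b ⊎ (a ≡ 2 + b × P) → a ≤ 2 + b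
  within-2 (inj₁ a≤1+b)  = m≤n⇒m≤1+n a≤1+b
  within-2 (inj₂ (e , _)) = ≤-reflexive e

near-below-strict : ∀ {x v} → Skip x → Skip (2 + x) → Near x v → x ≤ 1 + v
near-below-strict {v = v} sx s2x near with near-below near
... | inj₁ x≤1+v    = x≤1+v
... | inj₂ (e , sv) = ⊥-elim (no-three-skips v sv (subst Skip e sx) (subst Skip (cong (2 +_) e) s2x))

near-above-strict : ∀ {x v} → ¬ Skip x → Near x v → v ≤ 1 + x
near-above-strict ¬sx near with near-above near
... | inj₁ v≤1+x    = v≤1+x
... | inj₂ (_ , sx) = ⊥-elim (¬sx sx)

forward-window : ∀ {x y} → x ↝ y → WithinWindow 5 (λ v → Near x v ⊎ Near y v)
forward-window (next x) = x , 2 , λ where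
  (inj₁ near) → let (lo , hi) = near-bounds near in lo , +-monoʳ-≤ 2 (m≤n⇒m≤1+n hi)
  (inj₂ near) → let (lo , hi) = near-bounds near in ≤-trans (n≤1+n x) lo , +-monoʳ-≤ 2 hi
forward-window (jump {x} sx) with skip? (2 + x)
... | yes s2x = x , 1 , λ where
  (inj₁ near) → let (_ , hi) = near-bounds near in
                 near-below-strict sx s2x near , s≤s (m≤n⇒m≤1+n (m≤n⇒m≤1+n hi))
  (inj₂ near) → let (lo , hi) = near-bounds near in
                 m≤n⇒m≤1+n (s≤s⁻¹ (s≤s⁻¹ lo)) , s≤s hi
... | no ¬s2x = x , 2 , λ where
  (inj₁ near) → let (lo , hi) = near-bounds near in lo , +-monoʳ-≤ 2 (m≤n⇒m≤1+n hi)
  (inj₂ near) → let (lo , _) = near-bounds near in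
                 ≤-trans (m≤n+m x 2) lo , +-monoʳ-≤ 2 (near-above-strict ¬s2x near)

linked-window : ∀ {x y} → Linked x y → WithinWindow 5 (λ v → Near x v ⊎ Near y v)
linked-window (inj₁ x↝y) = forward-window x↝y
linked-window (inj₂ y↝x) = let (s , d , window) = forward-window y↝x in s , d , window ∘ swap

backDegree-linked : ∀ k → backDegree (2 + k) ≡ 1 + indicator (does (skip? k))
backDegree-linked k = begin
  backDegree (2 + k)
    ≡⟨⟩
  ∑[ u < k ] indicator (does (linked? u (2 + k)))
    + indicator (does (linked? k (2 + k))) + indicator (does (linked? (1 + k) (2 + k)))
    ≡⟨ cong₂ _+_ (cong₂ _+_ (sumBelow-zero k too-far) (cong indicator skip-edge))
                 (cong indicator (dec-true (linked? (1 + k) (2 + k)) (inj₁ (next _)))) ⟩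
  0 + indicator (does (skip? k)) + 1
    ≡⟨ +-comm _ 1 ⟩
  1 + indicator (does (skip? k)) ∎
  where
  open ≡-Reasoning
  too-far : ∀ {u} → u < k → indicator (does (linked? u (2 + k))) ≡ 0
  too-far {u} u<k = cong indicator (dec-false (linked? u (2 + k)) λ linked →
    <⇒≱ u<k (s≤s⁻¹ (s≤s⁻¹ (proj₂ (near-bounds (inj₂ linked))))))
  from-skip-edge : Linked k (2 + k) → Skip k
  from-skip-edge (inj₁ (jump sk)) = sk
  from-skip-edge (inj₂ ())
  skip-edge : does (linked? k (2 + k)) ≡ does (skip? k)
  skip-edge = does-⇔ (mk⇔ from-skip-edge (inj₁ ∘ jump)) (linked? k (2 + k)) (skip? k)

backDegrees-over-period : ∀ k → ∑[ j < 6 ] backDegree (j + (2 + k)) ≡ 10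
backDegrees-over-period k = trans (sumBelow-cong 6 by-residue) (over-period (k % 6) (m%n<n k 6))
  where
  open ≡-Reasoning
  by-residue : ∀ {j} → j < 6 → backDegree (j + (2 + k)) ≡ 1 + indicator (does ((k % 6 + j) % 6 <? 4))
  by-residue {j} j<6 = begin
    backDegree (j + (2 + k))             ≡⟨ cong backDegree (+-comm j (2 + k)) ⟩
    backDegree (2 + (k + j))             ≡⟨ backDegree-linked (k + j) ⟩
    1 + indicator (does (skip? (k + j))) ≡⟨ cong (λ r → 1 + indicator (does (r <? 4))) residue ⟩
    1 + indicator (does ((k % 6 + j) % 6 <? 4)) ∎
    where
    residue : (k + j) % 6 ≡ (k % 6 + j) % 6
    residue = trans (%-distribˡ-+ k j 6) (cong (λ t → (k % 6 + t) % 6) (m<n⇒m%n≡m j<6))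
  over-period : ∀ r → r < 6 → ∑[ j < 6 ] (1 + indicator (does ((r + j) % 6 <? 4))) ≡ 10
  over-period 0 _ = refl
  over-period 1 _ = refl
  over-period 2 _ = refl
  over-period 3 _ = refl
  over-period 4 _ = refl
  over-period 5 _ = refl
  over-period (suc (suc (suc (suc (suc (suc r)))))) r<6 = contradiction r<6 (m+n≮m 6 r)

threeBound-6+ : ∀ m → 2 ≤ m → threeBound (6 + m) ≡ 30 + threeBound m
threeBound-6+ m 2≤m with m % 6
... | 0 = trans (cong (_∸ 3) (*-distribˡ-+ 5 6 m))
              (+-∸-assoc 30 (≤-trans (m≤m+n 3 7) (*-monoʳ-≤ 5 2≤m)))
... | 1 = trans (cong (_∸ 5) (*-distribˡ-+ 5 6 m))
              (+-∸-assoc 30 (≤-trans (m≤m+n 5 5) (*-monoʳ-≤ 5 2≤m)))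
... | suc (suc i) =
  trans (cong (_∸ 9) (trans (cong (_+ suc (suc i)) (*-distribˡ-+ 5 6 m)) (+-assoc 30 (5 * m) (2 + i))))
        (+-∸-assoc 30 (≤-trans (m≤m+n 9 1) (≤-trans (*-monoʳ-≤ 5 2≤m) (m≤m+n (5 * m) (2 + i)))))

3*edgeCount≡threeBound : ∀ n → 3 * edgeCount (induced n) ≡ threeBound n
3*edgeCount≡threeBound 0 = refl
3*edgeCount≡threeBound 1 = refl
3*edgeCount≡threeBound 2 = refl
3*edgeCount≡threeBound 3 = refl
3*edgeCount≡threeBound 4 = refl
3*edgeCount≡threeBound 5 = refl
3*edgeCount≡threeBound 6 = refl
3*edgeCount≡threeBound 7 = refl
3*edgeCount≡threeBound (suc (suc (suc (suc (suc (suc (suc (suc k)))))))) = begin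
  3 * edgeCount (induced (8 + k))         ≡⟨ cong (3 *_) (edgeCount-induced-+ 6 (2 + k)) ⟩
  3 * (edgeCount (induced (2 + k)) + ∑[ j < 6 ] backDegree (j + (2 + k)))
    ≡⟨ cong (λ e → 3 * (edgeCount (induced (2 + k)) + e)) (backDegrees-over-period k) ⟩
  3 * (edgeCount (induced (2 + k)) + 10)  ≡⟨ *-distribˡ-+ 3 (edgeCount (induced (2 + k))) 10 ⟩
  3 * edgeCount (induced (2 + k)) + 30    ≡⟨ cong (_+ 30) (3*edgeCount≡threeBound (suc (suc k))) ⟩
  threeBound (2 + k) + 30                 ≡⟨ +-comm (threeBound (2 + k)) 30 ⟩
  30 + threeBound (2 + k)                 ≡⟨ threeBound-6+ (2 + k) (s≤s (s≤s z≤n)) ⟨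
  threeBound (8 + k)                      ∎
  where open ≡-Reasoning

-- The construction attains the bound with equality for every n.
theorem5 : ∀ (n : ℕ) → 7 ≤ n →
    Σ (Graph n) λ G → Outerplanar G × Free (doubleStar 2 3) G × threeBound n ≤ 3 * edgeCount G
theorem5 n _ =
  induced n ,
  induced-outerplanar linked-short n ,
  induced-doubleStar-free 2 3 linked-window n ,
  ≤-reflexive (sym (3*edgeCount≡threeBound n))
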